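{- Let $\varphi$ be a formula in the language of $\mathsf{E}\text{ - }\mathsf{HA}^\omega$ (i.e. of $\mathsf{HA}^\omega$) with free variables $x_1,\ldots,x_n$ of types $\sigma_1,\ldots,\sigma_n$, and let $\varphi^*$ be the formula of the language of $\mathsf{HE}\text{ - }\mathsf{HA}^\omega$ obtained from $\varphi$ by replacing every $s\equiv_\sigma t$ by $s=_\sigma t$, every $\forall x:\sigma$ by $\forall^{\mathrm{Ext}}x:\sigma$ and every $\exists x:\sigma$ by $\exists^{\mathrm{Ext}}x:\sigma$. Then $\mathsf{E}\text{ - }\mathsf{HA}^\omega\vdash\varphi$ if and only if $\mathsf{HE}\text{ - }\mathsf{HA}^\omega\vdash\mathrm{Ext}_{\sigma_1}(x_1)\to\cdots\to\mathrm{Ext}_{\sigma_n}(x_n)\to\varphi^*$.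
   Context: Finite types are generated by: $0$ is a type; if $\sigma,\tau$ are types, so are $\sigma\times\tau$ and $\sigma\to\tau$. $\mathsf{HA}^\omega$ is the many-sorted intuitionistic first-order theory whose sorts are the finite types. Its terms are built from variables and, for all types $\rho,\sigma,\tau$, the constants $\mathsf{k}:\rho\to\sigma\to\rho$, $\mathsf{s}:(\rho\to\sigma\to\tau)\to(\rho\to\sigma)\to(\rho\to\tau)$, $\mathsf{pair}:\sigma\to\tau\to\sigma\times\tau$, $\mathsf{fst}:\sigma\times\tau\to\sigma$, $\mathsf{snd}:\sigma\times\tau\to\tau$, $0:0$, $S:0\to0$, $\mathsf{R}:\sigma\to(0\to\sigma\to\sigma)\to0\to\sigma$, by application (associating to the left). Atomic formulas are $\bot$ and $s\equiv_\sigma t$. Axioms: $\equiv_\sigma$ is an equivalence relation; $x\equiv x'\to y\equiv y'\to xy\equiv x'y'$; $\mathsf{k}xy\equiv x$; $\mathsf{s}xyz\equiv xz(yz)$; $\mathsf{fst}(\mathsf{pair}\,xy)\equiv x$; $\mathsf{snd}(\mathsf{pair}\,xy)\equiv y$; $\mathsf{R}xy0\equiv x$; $\mathsf{R}xy(Sm)\equiv ym(\mathsf{R}xym)$; $Sx\equiv_0Sy\to x\equiv_0y$; $\neg(Sx\equiv_00)$; induction for all formulas. $\mathsf{E}\text{ - }\mathsf{HA}^\omega$ is $\mathsf{HA}^\omega$ plus $x\equiv_{\sigma\times\tau}y\leftrightarrow(\mathsf{fst}\,x\equiv_\sigma\mathsf{fst}\,y\wedge\mathsf{snd}\,x\equiv_\tau\mathsf{snd}\,y)$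 and $f\equiv_{\sigma\to\tau}g\leftrightarrow\forall x:\sigma.fx\equiv_\tau gx$ for all $\sigma,\tau$. $\mathsf{H}\text{ - }\mathsf{HA}^\omega$ extends the language of $\mathsf{HA}^\omega$ with, for each type $\sigma$, a unary predicate $\mathrm{Ext}_\sigma$ and a binary predicate $=_\sigma$; $\forall^{\mathrm{Ext}}x:\sigma.\psi$ abbreviates $\forall x:\sigma(\mathrm{Ext}_\sigma(x)\to\psi)$ and $\exists^{\mathrm{Ext}}x:\sigma.\psi$ abbreviates $\exists x:\sigma(\mathrm{Ext}_\sigma(x)\wedge\psi)$. Its axioms are those of $\mathsf{HA}^\omega$, induction for all formulas of the extended language, and for all $\sigma,\tau$: $x=_0y\leftrightarrow x\equiv_0y$; $\forall x:0\,\mathrm{Ext}_0(x)$; $x=_{\sigma\times\tau}y\leftrightarrow(\mathsf{fst}\,x=_\sigma\mathsf{fst}\,y\wedge\mathsf{snd}\,x=_\tau\mathsf{snd}\,y)$; $\mathrm{Ext}_{\sigma\times\tau}(x)\leftrightarrow(\mathrm{Ext}_\sigma(\mathsf{fst}\,x)\wedge\mathrm{Ext}_\tau(\mathsf{snd}\,x))$; $f=_{\sigma\to\tau}g\leftrightarrow\forall^{\mathrm{Ext}}x:\sigma.fx=_\tau gx$; $\mathrm{Ext}_{\sigma\to\tau}(f)\to\mathrm{Ext}_\sigma(x)\to\mathrm{Ext}_\tau(fx)$; $x\equiv_\sigma y\to\mathrm{Ext}_\sigma(x)\to\mathrm{Ext}_\sigma(y)$; $\mathrm{Ext}(c)$ for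 each constant $c$. $\mathsf{HE}\text{ - }\mathsf{HA}^\omega$ is $\mathsf{H}\text{ - }\mathsf{HA}^\omega$ plus, for all $\sigma,\tau$, the axiom $\mathrm{Ext}_{\sigma\to\tau}(f)\to\mathrm{Ext}_\sigma(x)\to\mathrm{Ext}_\sigma(y)\to x=_\sigma y\to fx=_\tau fy$. -}

module Defs where

open import Data.List using (List; []; _∷_; map; foldr)
open import Data.List.Membership.Propositional using (_∈_)
open import Data.Product using (Σ; _,_)

infixr 7 _×ᵗ_
infixr 6 _→ᵗ_

data Ty : Set where
  nat   : Ty
  _×ᵗ_  : Ty → Ty → Ty
  _→ᵗ_  : Ty → Ty → Ty

Ctx : Set
Ctx = List Ty

data Var : Ctx → Ty → Set where
  vz : ∀ {Γ σ} → Var (σ ∷ Γ) σ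
  vs : ∀ {Γ σ τ} → Var Γ σ → Var (τ ∷ Γ) σ

data Const : Ty → Set where
  K    : ∀ ρ σ → Const (ρ →ᵗ σ →ᵗ ρ)
  S    : ∀ ρ σ τ → Const ((ρ →ᵗ σ →ᵗ τ) →ᵗ (ρ →ᵗ σ) →ᵗ (ρ →ᵗ τ))
  Pair : ∀ σ τ → Const (σ →ᵗ τ →ᵗ σ ×ᵗ τ)
  Fst  : ∀ σ τ → Const (σ ×ᵗ τ →ᵗ σ)
  Snd  : ∀ σ τ → Const (σ ×ᵗ τ →ᵗ τ)
  Zero : Const nat
  Succ : Const (nat →ᵗ nat)
  Rec  : ∀ σ → Const (σ →ᵗ (nat →ᵗ σ →ᵗ σ) →ᵗ nat →ᵗ σ)

infixl 9 _·_

data Tm (Γ : Ctx) : Ty → Set where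
  var : ∀ {σ} → Var Γ σ → Tm Γ σ
  con : ∀ {σ} → Const σ → Tm Γ σ
  _·_ : ∀ {σ τ} → Tm Γ (σ →ᵗ τ) → Tm Γ σ → Tm Γ τ

Ren : Ctx → Ctx → Set
Ren Γ Δ = ∀ {σ} → Var Γ σ → Var Δ σ

liftR : ∀ {Γ Δ τ} → Ren Γ Δ → Ren (τ ∷ Γ) (τ ∷ Δ)
liftR ρ vz     = vz
liftR ρ (vs x) = vs (ρ x)

renT : ∀ {Γ Δ σ} → Ren Γ Δ → Tm Γ σ → Tm Δ σ
renT ρ (var x) = var (ρ x)
renT ρ (con c) = con c
renT ρ (t · u) = renT ρ t · renT ρ u

wkT : ∀ {Γ σ τ} → Tm Γ σ → Tm (τ ∷ Γ) σ
wkT = renT vs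

Sub : Ctx → Ctx → Set
Sub Γ Δ = ∀ {σ} → Var Γ σ → Tm Δ σ

liftS : ∀ {Γ Δ τ} → Sub Γ Δ → Sub (τ ∷ Γ) (τ ∷ Δ)
liftS θ vz     = var vz
liftS θ (vs x) = wkT (θ x)

subT : ∀ {Γ Δ σ} → Sub Γ Δ → Tm Γ σ → Tm Δ σ
subT θ (var x) = θ x
subT θ (con c) = con c
subT θ (t · u) = subT θ t · subT θ u

zeroᵗ : ∀ {Γ} → Tm Γ nat
zeroᵗ = con Zero

succᵗ : ∀ {Γ} → Tm Γ nat → Tm Γ nat
succᵗ t = con Succ · t

-- Formulas.  'plain' = language of HA^ω (= of E-HA^ω);
-- 'hered' = extended language of H-HA^ω / HE-HA^ω (with Ext_σ and =_σ).

data Lang : Set where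
  plain hered : Lang

infix  8 _≣_ _≐_
infixr 6 _∧_
infixr 5 _∨_
infixr 4 _⊃_

data Fm : Lang → Ctx → Set where
  ⊥̇   : ∀ {L Γ} → Fm L Γ
  _≣_ : ∀ {L Γ σ} → Tm Γ σ → Tm Γ σ → Fm L Γ
  Ext : ∀ {Γ σ} → Tm Γ σ → Fm hered Γ
  _≐_ : ∀ {Γ σ} → Tm Γ σ → Tm Γ σ → Fm hered Γ
  _∧_ : ∀ {L Γ} → Fm L Γ → Fm L Γ → Fm L Γ
  _∨_ : ∀ {L Γ} → Fm L Γ → Fm L Γ → Fm L Γ
  _⊃_ : ∀ {L Γ} → Fm L Γ → Fm L Γ → Fm L Γ
  ∀̇   : ∀ {L Γ} σ → Fm L (σ ∷ Γ) → Fm L Γ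
  ∃̇   : ∀ {L Γ} σ → Fm L (σ ∷ Γ) → Fm L Γ

¬̇_ : ∀ {L Γ} → Fm L Γ → Fm L Γ
¬̇ φ = φ ⊃ ⊥̇

infix 3 _⟺_
_⟺_ : ∀ {L Γ} → Fm L Γ → Fm L Γ → Fm L Γ
φ ⟺ ψ = (φ ⊃ ψ) ∧ (ψ ⊃ φ)

renF : ∀ {L Γ Δ} → Ren Γ Δ → Fm L Γ → Fm L Δ
renF ρ ⊥̇       = ⊥̇
renF ρ (s ≣ t) = renT ρ s ≣ renT ρ t
renF ρ (Ext t) = Ext (renT ρ t)
renF ρ (s ≐ t) = renT ρ s ≐ renT ρ t
renF ρ (φ ∧ ψ) = renF ρ φ ∧ renF ρ ψ
renF ρ (φ ∨ ψ) = renF ρ φ ∨ renF ρ ψ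
renF ρ (φ ⊃ ψ) = renF ρ φ ⊃ renF ρ ψ
renF ρ (∀̇ σ φ) = ∀̇ σ (renF (liftR ρ) φ)
renF ρ (∃̇ σ φ) = ∃̇ σ (renF (liftR ρ) φ)

wkF : ∀ {L Γ τ} → Fm L Γ → Fm L (τ ∷ Γ)
wkF = renF vs

subF : ∀ {L Γ Δ} → Sub Γ Δ → Fm L Γ → Fm L Δ
subF θ ⊥̇       = ⊥̇
subF θ (s ≣ t) = subT θ s ≣ subT θ t
subF θ (Ext t) = Ext (subT θ t)
subF θ (s ≐ t) = subT θ s ≐ subT θ t
subF θ (φ ∧ ψ) = subF θ φ ∧ subF θ ψ
subF θ (φ ∨ ψ) = subF θ φ ∨ subF θ ψ
subF θ (φ ⊃ ψ) = subF θ φ ⊃ subF θ ψ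
subF θ (∀̇ σ φ) = ∀̇ σ (subF (liftS θ) φ)
subF θ (∃̇ σ φ) = ∃̇ σ (subF (liftS θ) φ)

sub0 : ∀ {Γ σ} → Tm Γ σ → Sub (σ ∷ Γ) Γ
sub0 t vz     = t
sub0 t (vs x) = var x

_[_] : ∀ {L Γ σ} → Fm L (σ ∷ Γ) → Tm Γ σ → Fm L Γ
φ [ t ] = subF (sub0 t) φ

succSub : ∀ {Γ} → Sub (nat ∷ Γ) (nat ∷ Γ)
succSub vz     = succᵗ (var vz)
succSub (vs x) = var (vs x)

Theory : Lang → Set₁
Theory L = (Γ : Ctx) → Fm L Γ → Set

data Deriv {L : Lang} (T : Theory L) : (Γ : Ctx) → List (Fm L Γ) → Fm L Γ → Set where
  hyp  : ∀ {Γ Δ φ} → φ ∈ Δ → Deriv T Γ Δ φ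
  ax   : ∀ {Γ Δ φ} → T Γ φ → Deriv T Γ Δ φ
  ⊥E   : ∀ {Γ Δ φ} → Deriv T Γ Δ ⊥̇ → Deriv T Γ Δ φ
  ∧I   : ∀ {Γ Δ φ ψ} → Deriv T Γ Δ φ → Deriv T Γ Δ ψ → Deriv T Γ Δ (φ ∧ ψ)
  ∧E₁  : ∀ {Γ Δ φ ψ} → Deriv T Γ Δ (φ ∧ ψ) → Deriv T Γ Δ φ
  ∧E₂  : ∀ {Γ Δ φ ψ} → Deriv T Γ Δ (φ ∧ ψ) → Deriv T Γ Δ ψ
  ∨I₁  : ∀ {Γ Δ φ ψ} → Deriv T Γ Δ φ → Deriv T Γ Δ (φ ∨ ψ)
  ∨I₂  : ∀ {Γ Δ φ ψ} → Deriv T Γ Δ ψ → Deriv T Γ Δ (φ ∨ ψ)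
  ∨E   : ∀ {Γ Δ φ ψ χ} → Deriv T Γ Δ (φ ∨ ψ) → Deriv T Γ (φ ∷ Δ) χ
         → Deriv T Γ (ψ ∷ Δ) χ → Deriv T Γ Δ χ
  ⊃I   : ∀ {Γ Δ φ ψ} → Deriv T Γ (φ ∷ Δ) ψ → Deriv T Γ Δ (φ ⊃ ψ)
  ⊃E   : ∀ {Γ Δ φ ψ} → Deriv T Γ Δ (φ ⊃ ψ) → Deriv T Γ Δ φ → Deriv T Γ Δ ψ
  ∀I   : ∀ {Γ Δ σ φ} → Deriv T (σ ∷ Γ) (map wkF Δ) φ → Deriv T Γ Δ (∀̇ σ φ)
  ∀E   : ∀ {Γ Δ σ φ} → Deriv T Γ Δ (∀̇ σ φ) → (t : Tm Γ σ) → Deriv T Γ Δ (φ [ t ])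
  ∃I   : ∀ {Γ Δ σ φ} → (t : Tm Γ σ) → Deriv T Γ Δ (φ [ t ]) → Deriv T Γ Δ (∃̇ σ φ)
  ∃E   : ∀ {Γ Δ σ φ ψ} → Deriv T Γ Δ (∃̇ σ φ)
         → Deriv T (σ ∷ Γ) (φ ∷ map wkF Δ) (wkF ψ) → Deriv T Γ Δ ψ

_⊢_ : ∀ {L Γ} → Theory L → Fm L Γ → Set
_⊢_ {Γ = Γ} T φ = Deriv T Γ [] φ

-- Axioms of HA^ω, for either language (induction for all formulas of L).
-- Axioms with free variables are given as schemata over arbitrary terms.

data HAax (L : Lang) : Theory L where
  ≡-refl  : ∀ {Γ σ} (t : Tm Γ σ) → HAax L Γ (t ≣ t)
  ≡-sym   : ∀ {Γ σ} (s t : Tm Γ σ) → HAax L Γ (s ≣ t ⊃ t ≣ s)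
  ≡-trans : ∀ {Γ σ} (s t u : Tm Γ σ) → HAax L Γ (s ≣ t ⊃ t ≣ u ⊃ s ≣ u)
  ≡-app   : ∀ {Γ σ τ} (x x' : Tm Γ (σ →ᵗ τ)) (y y' : Tm Γ σ)
            → HAax L Γ (x ≣ x' ⊃ y ≣ y' ⊃ (x · y) ≣ (x' · y'))
  k-ax    : ∀ {Γ ρ σ} (x : Tm Γ ρ) (y : Tm Γ σ) → HAax L Γ (con (K ρ σ) · x · y ≣ x)
  s-ax    : ∀ {Γ ρ σ τ} (x : Tm Γ (ρ →ᵗ σ →ᵗ τ)) (y : Tm Γ (ρ →ᵗ σ)) (z : Tm Γ ρ)
            → HAax L Γ (con (S ρ σ τ) · x · y · z ≣ x · z · (y · z))
  fst-ax  : ∀ {Γ σ τ} (x : Tm Γ σ) (y : Tm Γ τ)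
            → HAax L Γ (con (Fst σ τ) · (con (Pair σ τ) · x · y) ≣ x)
  snd-ax  : ∀ {Γ σ τ} (x : Tm Γ σ) (y : Tm Γ τ)
            → HAax L Γ (con (Snd σ τ) · (con (Pair σ τ) · x · y) ≣ y)
  R0-ax   : ∀ {Γ σ} (x : Tm Γ σ) (y : Tm Γ (nat →ᵗ σ →ᵗ σ))
            → HAax L Γ (con (Rec σ) · x · y · zeroᵗ ≣ x)
  RS-ax   : ∀ {Γ σ} (x : Tm Γ σ) (y : Tm Γ (nat →ᵗ σ →ᵗ σ)) (m : Tm Γ nat)
            → HAax L Γ (con (Rec σ) · x · y · succᵗ m ≣ y · m · (con (Rec σ) · x · y · m))
  S-inj   : ∀ {Γ} (x y : Tm Γ nat) → HAax L Γ (succᵗ x ≣ succᵗ y ⊃ x ≣ y)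
  S≢0     : ∀ {Γ} (x : Tm Γ nat) → HAax L Γ (¬̇ (succᵗ x ≣ zeroᵗ))
  ind     : ∀ {Γ} (φ : Fm L (nat ∷ Γ))
            → HAax L Γ (φ [ zeroᵗ ] ⊃ ∀̇ nat (φ ⊃ subF succSub φ) ⊃ ∀̇ nat φ)

data EHA : Theory plain where
  base   : ∀ {Γ φ} → HAax plain Γ φ → EHA Γ φ
  ext-×  : ∀ {Γ σ τ} (x y : Tm Γ (σ ×ᵗ τ))
           → EHA Γ (x ≣ y ⟺ (con (Fst σ τ) · x ≣ con (Fst σ τ) · y
                              ∧ con (Snd σ τ) · x ≣ con (Snd σ τ) · y))
  ext-→  : ∀ {Γ σ τ} (f g : Tm Γ (σ →ᵗ τ))
           → EHA Γ (f ≣ g ⟺ ∀̇ σ (wkT f · var vz ≣ wkT g · var vz))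

data HHA : Theory hered where
  base    : ∀ {Γ φ} → HAax hered Γ φ → HHA Γ φ
  =₀      : ∀ {Γ} (x y : Tm Γ nat) → HHA Γ (x ≐ y ⟺ x ≣ y)
  Ext₀    : ∀ {Γ} → HHA Γ (∀̇ nat (Ext (var vz)))
  =×      : ∀ {Γ σ τ} (x y : Tm Γ (σ ×ᵗ τ))
            → HHA Γ (x ≐ y ⟺ (con (Fst σ τ) · x ≐ con (Fst σ τ) · y
                               ∧ con (Snd σ τ) · x ≐ con (Snd σ τ) · y))
  Ext×    : ∀ {Γ σ τ} (x : Tm Γ (σ ×ᵗ τ))
            → HHA Γ (Ext x ⟺ (Ext (con (Fst σ τ) · x) ∧ Ext (con (Snd σ τ) · x)))
  =→      : ∀ {Γ σ τ} (f g : Tm Γ (σ →ᵗ τ))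
            → HHA Γ (f ≐ g ⟺ ∀̇ σ (Ext (var vz) ⊃ wkT f · var vz ≐ wkT g · var vz))
  Ext-app : ∀ {Γ σ τ} (f : Tm Γ (σ →ᵗ τ)) (x : Tm Γ σ)
            → HHA Γ (Ext f ⊃ Ext x ⊃ Ext (f · x))
  Ext-≡   : ∀ {Γ σ} (x y : Tm Γ σ) → HHA Γ (x ≣ y ⊃ Ext x ⊃ Ext y)
  Ext-con : ∀ {Γ σ} (c : Const σ) → HHA Γ (Ext (con c))

data HEHA : Theory hered where
  base : ∀ {Γ φ} → HHA Γ φ → HEHA Γ φ
  he   : ∀ {Γ σ τ} (f : Tm Γ (σ →ᵗ τ)) (x y : Tm Γ σ)
         → HEHA Γ (Ext f ⊃ Ext x ⊃ Ext y ⊃ x ≐ y ⊃ (f · x) ≐ (f · y))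

_* : ∀ {Γ} → Fm plain Γ → Fm hered Γ
⊥̇ *       = ⊥̇
(s ≣ t) * = s ≐ t
(φ ∧ ψ) * = φ * ∧ ψ *
(φ ∨ ψ) * = φ * ∨ ψ *
(φ ⊃ ψ) * = φ * ⊃ ψ *
(∀̇ σ φ) * = ∀̇ σ (Ext (var vz) ⊃ φ *)
(∃̇ σ φ) * = ∃̇ σ (Ext (var vz) ∧ φ *)

vars : (Γ : Ctx) → List (Σ Ty (Var Γ))
vars []      = []
vars (σ ∷ Γ) = (σ , vz) ∷ map (λ { (τ , x) → τ , vs x }) (vars Γ)

extGuard : (Γ : Ctx) → Fm hered Γ → Fm hered Γ
extGuard Γ ψ = foldr (λ { (σ , x) χ → Ext (var x) ⊃ χ }) ψ (vars Γ)

{-# OPTIONS --safe #-}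
-- Erasing Ext and reading =_σ as ≡_σ maps every axiom of HE-HA^ω to a theorem of E-HA^ω
-- (hereditary extensionality becomes congruence of application, =→ becomes ext-→), and the
-- erasure of φ* is φ up to the trivial guards ⊤ ⊃ _ and ⊤ ∧ _.  Conversely, in HE-HA^ω every
-- term built from extensional variables is extensional, ≡_σ implies =_σ by induction on σ,
-- and =_σ is an equivalence relation which, thanks to the axiom of HE-HA^ω, is a congruence
-- for application; so each axiom of E-HA^ω holds in its *-translation, and a derivation is
-- translated rule by rule while Ext of every free variable stays among the hypotheses.
module Submission where

open import Defs
open import Function.Bundles using (_⇔_; mk⇔)
open import Data.List using (List; []; _∷_; map; foldr)
open import Data.List.Membership.Propositional using (_∈_)
open import Data.List.Membership.Propositional.Properties using (∈-map⁺; ∈-map⁻)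
open import Data.List.Relation.Unary.Any using (here; there)
open import Data.Product using (Σ; _,_)
open import Data.Sum using (_⊎_; inj₁; inj₂)
open import Relation.Binary.PropositionalEquality using (_≡_; refl; sym; trans; cong; cong₂; subst)

subT-renT : ∀ {Γ Δ Ε σ} (ρ : Ren Γ Δ) (θ : Sub Δ Ε) (θ' : Sub Γ Ε)
          → (∀ {τ} (x : Var Γ τ) → θ (ρ x) ≡ θ' x) → (t : Tm Γ σ) → subT θ (renT ρ t) ≡ subT θ' t
subT-renT ρ θ θ' eq (var x) = eq x
subT-renT ρ θ θ' eq (con c) = refl
subT-renT ρ θ θ' eq (t · u) = cong₂ _·_ (subT-renT ρ θ θ' eq t) (subT-renT ρ θ θ' eq u)

liftS-liftR : ∀ {Γ Δ Ε σ} (ρ : Ren Γ Δ) (θ : Sub Δ Ε) (θ' : Sub Γ Ε)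
            → (∀ {τ} (x : Var Γ τ) → θ (ρ x) ≡ θ' x)
            → ∀ {τ} (x : Var (σ ∷ Γ) τ) → liftS θ (liftR ρ x) ≡ liftS θ' x
liftS-liftR ρ θ θ' eq vz     = refl
liftS-liftR ρ θ θ' eq (vs x) = cong wkT (eq x)

subF-renF : ∀ {L Γ Δ Ε} (ρ : Ren Γ Δ) (θ : Sub Δ Ε) (θ' : Sub Γ Ε)
          → (∀ {τ} (x : Var Γ τ) → θ (ρ x) ≡ θ' x) → (φ : Fm L Γ) → subF θ (renF ρ φ) ≡ subF θ' φ
subF-renF ρ θ θ' eq ⊥̇       = refl
subF-renF ρ θ θ' eq (s ≣ t) = cong₂ _≣_ (subT-renT ρ θ θ' eq s) (subT-renT ρ θ θ' eq t)
subF-renF ρ θ θ' eq (Ext t) = cong Ext (subT-renT ρ θ θ' eq t)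
subF-renF ρ θ θ' eq (s ≐ t) = cong₂ _≐_ (subT-renT ρ θ θ' eq s) (subT-renT ρ θ θ' eq t)
subF-renF ρ θ θ' eq (φ ∧ ψ) = cong₂ _∧_ (subF-renF ρ θ θ' eq φ) (subF-renF ρ θ θ' eq ψ)
subF-renF ρ θ θ' eq (φ ∨ ψ) = cong₂ _∨_ (subF-renF ρ θ θ' eq φ) (subF-renF ρ θ θ' eq ψ)
subF-renF ρ θ θ' eq (φ ⊃ ψ) = cong₂ _⊃_ (subF-renF ρ θ θ' eq φ) (subF-renF ρ θ θ' eq ψ)
subF-renF ρ θ θ' eq (∀̇ σ φ) =
  cong (∀̇ σ) (subF-renF (liftR ρ) (liftS θ) (liftS θ') (liftS-liftR ρ θ θ' eq) φ)
subF-renF ρ θ θ' eq (∃̇ σ φ) =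
  cong (∃̇ σ) (subF-renF (liftR ρ) (liftS θ) (liftS θ') (liftS-liftR ρ θ θ' eq) φ)

subT-id : ∀ {Γ σ} (θ : Sub Γ Γ) → (∀ {τ} (x : Var Γ τ) → θ x ≡ var x) → (t : Tm Γ σ) → subT θ t ≡ t
subT-id θ eq (var x) = eq x
subT-id θ eq (con c) = refl
subT-id θ eq (t · u) = cong₂ _·_ (subT-id θ eq t) (subT-id θ eq u)

liftS-id : ∀ {Γ σ} (θ : Sub Γ Γ) → (∀ {τ} (x : Var Γ τ) → θ x ≡ var x)
         → ∀ {τ} (x : Var (σ ∷ Γ) τ) → liftS θ x ≡ var x
liftS-id θ eq vz     = refl
liftS-id θ eq (vs x) = cong wkT (eq x)

subF-id : ∀ {L Γ} (θ : Sub Γ Γ) → (∀ {τ} (x : Var Γ τ) → θ x ≡ var x) → (φ : Fm L Γ) → subF θ φ ≡ φ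
subF-id θ eq ⊥̇       = refl
subF-id θ eq (s ≣ t) = cong₂ _≣_ (subT-id θ eq s) (subT-id θ eq t)
subF-id θ eq (Ext t) = cong Ext (subT-id θ eq t)
subF-id θ eq (s ≐ t) = cong₂ _≐_ (subT-id θ eq s) (subT-id θ eq t)
subF-id θ eq (φ ∧ ψ) = cong₂ _∧_ (subF-id θ eq φ) (subF-id θ eq ψ)
subF-id θ eq (φ ∨ ψ) = cong₂ _∨_ (subF-id θ eq φ) (subF-id θ eq ψ)
subF-id θ eq (φ ⊃ ψ) = cong₂ _⊃_ (subF-id θ eq φ) (subF-id θ eq ψ)
subF-id θ eq (∀̇ σ φ) = cong (∀̇ σ) (subF-id (liftS θ) (liftS-id θ eq) φ)
subF-id θ eq (∃̇ σ φ) = cong (∃̇ σ) (subF-id (liftS θ) (liftS-id θ eq) φ)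

-- renF (liftR vs) φ is the body of wkF (∀̇ σ φ) and of wkF (∃̇ σ φ).
weakened-body-at-var0 : ∀ {L Γ σ} (φ : Fm L (σ ∷ Γ)) → (renF (liftR vs) φ) [ var vz ] ≡ φ
weakened-body-at-var0 φ = trans (subF-renF (liftR vs) (sub0 (var vz)) var sub0-liftR φ) (subF-id var (λ _ → refl) φ)
  where
  sub0-liftR : ∀ {τ} (x : Var _ τ) → sub0 (var vz) (liftR vs x) ≡ var x
  sub0-liftR vz     = refl
  sub0-liftR (vs x) = refl

subT-sub0-wkT : ∀ {Γ σ τ} (x : Tm Γ σ) (f : Tm Γ τ) → subT (sub0 x) (wkT f) ≡ f
subT-sub0-wkT x f = trans (subT-renT vs (sub0 x) var (λ _ → refl) f) (subT-id var (λ _ → refl) f)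

*-renF : ∀ {Γ Δ} (ρ : Ren Γ Δ) (φ : Fm plain Γ) → (renF ρ φ) * ≡ renF ρ (φ *)
*-renF ρ ⊥̇       = refl
*-renF ρ (s ≣ t) = refl
*-renF ρ (φ ∧ ψ) = cong₂ _∧_ (*-renF ρ φ) (*-renF ρ ψ)
*-renF ρ (φ ∨ ψ) = cong₂ _∨_ (*-renF ρ φ) (*-renF ρ ψ)
*-renF ρ (φ ⊃ ψ) = cong₂ _⊃_ (*-renF ρ φ) (*-renF ρ ψ)
*-renF ρ (∀̇ σ φ) = cong (λ χ → ∀̇ σ (Ext (var vz) ⊃ χ)) (*-renF (liftR ρ) φ)
*-renF ρ (∃̇ σ φ) = cong (λ χ → ∃̇ σ (Ext (var vz) ∧ χ)) (*-renF (liftR ρ) φ)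

*-subF : ∀ {Γ Δ} (θ : Sub Γ Δ) (φ : Fm plain Γ) → (subF θ φ) * ≡ subF θ (φ *)
*-subF θ ⊥̇       = refl
*-subF θ (s ≣ t) = refl
*-subF θ (φ ∧ ψ) = cong₂ _∧_ (*-subF θ φ) (*-subF θ ψ)
*-subF θ (φ ∨ ψ) = cong₂ _∨_ (*-subF θ φ) (*-subF θ ψ)
*-subF θ (φ ⊃ ψ) = cong₂ _⊃_ (*-subF θ φ) (*-subF θ ψ)
*-subF θ (∀̇ σ φ) = cong (λ χ → ∀̇ σ (Ext (var vz) ⊃ χ)) (*-subF (liftS θ) φ)
*-subF θ (∃̇ σ φ) = cong (λ χ → ∃̇ σ (Ext (var vz) ∧ χ)) (*-subF (liftS θ) φ)

⊤̇ : ∀ {Γ} → Fm plain Γ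
⊤̇ = ⊥̇ ⊃ ⊥̇

erase : ∀ {Γ} → Fm hered Γ → Fm plain Γ
erase ⊥̇       = ⊥̇
erase (s ≣ t) = s ≣ t
erase (Ext t) = ⊤̇
erase (s ≐ t) = s ≣ t
erase (φ ∧ ψ) = erase φ ∧ erase ψ
erase (φ ∨ ψ) = erase φ ∨ erase ψ
erase (φ ⊃ ψ) = erase φ ⊃ erase ψ
erase (∀̇ σ φ) = ∀̇ σ (erase φ)
erase (∃̇ σ φ) = ∃̇ σ (erase φ)

erase-renF : ∀ {Γ Δ} (ρ : Ren Γ Δ) (φ : Fm hered Γ) → erase (renF ρ φ) ≡ renF ρ (erase φ)
erase-renF ρ ⊥̇       = refl
erase-renF ρ (s ≣ t) = refl
erase-renF ρ (Ext t) = refl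
erase-renF ρ (s ≐ t) = refl
erase-renF ρ (φ ∧ ψ) = cong₂ _∧_ (erase-renF ρ φ) (erase-renF ρ ψ)
erase-renF ρ (φ ∨ ψ) = cong₂ _∨_ (erase-renF ρ φ) (erase-renF ρ ψ)
erase-renF ρ (φ ⊃ ψ) = cong₂ _⊃_ (erase-renF ρ φ) (erase-renF ρ ψ)
erase-renF ρ (∀̇ σ φ) = cong (∀̇ σ) (erase-renF (liftR ρ) φ)
erase-renF ρ (∃̇ σ φ) = cong (∃̇ σ) (erase-renF (liftR ρ) φ)

erase-subF : ∀ {Γ Δ} (θ : Sub Γ Δ) (φ : Fm hered Γ) → erase (subF θ φ) ≡ subF θ (erase φ)
erase-subF θ ⊥̇       = refl
erase-subF θ (s ≣ t) = refl
erase-subF θ (Ext t) = refl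
erase-subF θ (s ≐ t) = refl
erase-subF θ (φ ∧ ψ) = cong₂ _∧_ (erase-subF θ φ) (erase-subF θ ψ)
erase-subF θ (φ ∨ ψ) = cong₂ _∨_ (erase-subF θ φ) (erase-subF θ ψ)
erase-subF θ (φ ⊃ ψ) = cong₂ _⊃_ (erase-subF θ φ) (erase-subF θ ψ)
erase-subF θ (∀̇ σ φ) = cong (∀̇ σ) (erase-subF (liftS θ) φ)
erase-subF θ (∃̇ σ φ) = cong (∃̇ σ) (erase-subF (liftS θ) φ)

Covers : ∀ {L L' Γ} → (Fm L Γ → Fm L' Γ) → List (Fm L Γ) → List (Fm L' Γ) → Set
Covers f Δ H = ∀ {ψ} → ψ ∈ Δ → f ψ ∈ H

covers-∷ : ∀ {L L' Γ} {f : Fm L Γ → Fm L' Γ} {Δ H} (A : Fm L Γ)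
         → Covers f Δ H → Covers f (A ∷ Δ) (f A ∷ H)
covers-∷ A c (here refl) = here refl
covers-∷ A c (there p)   = there (c p)

covers-wkF : ∀ {L L'} (f : ∀ {Γ} → Fm L Γ → Fm L' Γ)
           → (∀ {Γ Δ} (ρ : Ren Γ Δ) (ψ : Fm L Γ) → f (renF ρ ψ) ≡ renF ρ (f ψ))
           → ∀ {Γ σ Δ H} → Covers f Δ H → Covers f (map (wkF {τ = σ}) Δ) (map (wkF {Γ = Γ}) H)
covers-wkF f f-renF c p with ∈-map⁻ wkF p
... | ψ , q , refl = subst (_∈ _) (sym (f-renF vs ψ)) (∈-map⁺ wkF (c q))

module _ {L : Lang} {T : Theory L} where

  private
    D = Deriv T

  hyp₀ : ∀ {Γ Δ A} → D Γ (A ∷ Δ) A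
  hyp₀ = hyp (here refl)

  hyp₁ : ∀ {Γ Δ A B} → D Γ (B ∷ A ∷ Δ) A
  hyp₁ = hyp (there (here refl))

  cut : ∀ {Γ Δ A B} → D Γ (A ∷ Δ) B → D Γ Δ A → D Γ Δ B
  cut d a = ⊃E (⊃I d) a

  ⟺-refl : ∀ {Γ Δ} {A : Fm L Γ} → D Γ Δ (A ⟺ A)
  ⟺-refl = ∧I (⊃I hyp₀) (⊃I hyp₀)

  ∀̇-mono : ∀ {Γ Δ σ A B} → (∀ Δ' → D (σ ∷ Γ) Δ' (A ⊃ B)) → D Γ Δ (∀̇ σ A ⊃ ∀̇ σ B)
  ∀̇-mono {A = A} f =
    ⊃I (∀I (⊃E (f _) (subst (D _ _) (weakened-body-at-var0 A) (∀E hyp₀ (var vz)))))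

  ∃̇-mono : ∀ {Γ Δ σ A B} → (∀ Δ' → D (σ ∷ Γ) Δ' (A ⊃ B)) → D Γ Δ (∃̇ σ A ⊃ ∃̇ σ B)
  ∃̇-mono {B = B} f =
    ⊃I (∃E hyp₀ (∃I (var vz) (subst (D _ _) (sym (weakened-body-at-var0 B)) (⊃E (f _) hyp₀))))

-- extGuard folds an anonymous pattern-matching lambda, which no other definition can mention,
-- so guards are handled over an arbitrary step function that computes like it.
GuardStep : (Γ : Ctx) → (Σ Ty (Var Γ) → Fm hered Γ → Fm hered Γ) → Set
GuardStep Γ step = ∀ {τ} (y : Var Γ τ) χ → step (τ , y) χ ≡ (Ext (var y) ⊃ χ)

module Erasure where

  private
    E = Deriv EHA

  ⊤̇-intro : ∀ {Γ Δ} → E Γ Δ ⊤̇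
  ⊤̇-intro = ⊃I hyp₀

  erase-HAax : ∀ {Γ φ} → HAax hered Γ φ → HAax plain Γ (erase φ)
  erase-HAax (≡-refl t)         = ≡-refl t
  erase-HAax (≡-sym s t)        = ≡-sym s t
  erase-HAax (≡-trans s t u)    = ≡-trans s t u
  erase-HAax (≡-app x x' y y')  = ≡-app x x' y y'
  erase-HAax (k-ax x y)         = k-ax x y
  erase-HAax (s-ax x y z)       = s-ax x y z
  erase-HAax (fst-ax x y)       = fst-ax x y
  erase-HAax (snd-ax x y)       = snd-ax x y
  erase-HAax (R0-ax x y)        = R0-ax x y
  erase-HAax (RS-ax x y m)      = RS-ax x y m
  erase-HAax (S-inj x y)        = S-inj x y
  erase-HAax (S≢0 x)            = S≢0 x
  erase-HAax (ind φ) rewrite erase-subF (sub0 zeroᵗ) φ | erase-subF succSub φ = ind (erase φ)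

  erase-axiom : ∀ {Γ Δ φ} → HEHA Γ φ → E Γ Δ (erase φ)
  erase-axiom (base (base a))      = ax (base (erase-HAax a))
  erase-axiom (base (=₀ x y))      = ⟺-refl
  erase-axiom (base Ext₀)          = ∀I ⊤̇-intro
  erase-axiom (base (=× x y))      = ax (ext-× x y)
  erase-axiom (base (Ext× x))      = ∧I (⊃I (∧I ⊤̇-intro ⊤̇-intro)) (⊃I ⊤̇-intro)
  erase-axiom (base (=→ f g))      =
    ∧I (⊃I (⊃E (∀̇-mono (λ _ → ⊃I (⊃I hyp₁))) (⊃E (∧E₁ (ax (ext-→ f g))) hyp₀)))
       (⊃I (⊃E (∧E₂ (ax (ext-→ f g))) (⊃E (∀̇-mono (λ _ → ⊃I (⊃E hyp₀ ⊤̇-intro))) hyp₀)))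
  erase-axiom (base (Ext-app f x)) = ⊃I (⊃I ⊤̇-intro)
  erase-axiom (base (Ext-≡ x y))   = ⊃I (⊃I ⊤̇-intro)
  erase-axiom (base (Ext-con c))   = ⊤̇-intro
  erase-axiom (he f x y)           =
    ⊃I (⊃I (⊃I (⊃I (⊃E (⊃E (ax (base (≡-app f f x y))) (ax (base (≡-refl f)))) hyp₀))))

  erase-deriv : ∀ {Γ Δ φ} → Deriv HEHA Γ Δ φ → (H : List (Fm plain Γ)) → Covers erase Δ H
              → E Γ H (erase φ)
  erase-deriv (hyp p)       H c = hyp (c p)
  erase-deriv (ax a)        H c = erase-axiom a
  erase-deriv (⊥E d)        H c = ⊥E (erase-deriv d H c)
  erase-deriv (∧I d e)      H c = ∧I (erase-deriv d H c) (erase-deriv e H c)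
  erase-deriv (∧E₁ d)       H c = ∧E₁ (erase-deriv d H c)
  erase-deriv (∧E₂ d)       H c = ∧E₂ (erase-deriv d H c)
  erase-deriv (∨I₁ d)       H c = ∨I₁ (erase-deriv d H c)
  erase-deriv (∨I₂ d)       H c = ∨I₂ (erase-deriv d H c)
  erase-deriv (∨E {φ = A} {ψ = B} d e f) H c =
    ∨E (erase-deriv d H c) (erase-deriv e _ (covers-∷ A c)) (erase-deriv f _ (covers-∷ B c))
  erase-deriv (⊃I {φ = A} d) H c = ⊃I (erase-deriv d _ (covers-∷ A c))
  erase-deriv (⊃E d e)      H c = ⊃E (erase-deriv d H c) (erase-deriv e H c)
  erase-deriv (∀I d)        H c = ∀I (erase-deriv d _ (covers-wkF erase erase-renF c))
  erase-deriv (∀E {φ = φ} d t) H c =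
    subst (E _ _) (sym (erase-subF (sub0 t) φ)) (∀E (erase-deriv d H c) t)
  erase-deriv (∃I {φ = φ} t d) H c =
    ∃I t (subst (E _ _) (erase-subF (sub0 t) φ) (erase-deriv d H c))
  erase-deriv (∃E {φ = φ} {ψ = ψ} d e) H c =
    ∃E (erase-deriv d H c)
       (subst (E _ _) (erase-renF vs ψ) (erase-deriv e _ (covers-∷ φ (covers-wkF erase erase-renF c))))

  erase-*-elim  : ∀ {Γ Δ} (φ : Fm plain Γ) → E Γ Δ (erase (φ *) ⊃ φ)
  erase-*-intro : ∀ {Γ Δ} (φ : Fm plain Γ) → E Γ Δ (φ ⊃ erase (φ *))
  erase-*-elim ⊥̇       = ⊃I hyp₀
  erase-*-elim (s ≣ t) = ⊃I hyp₀
  erase-*-elim (φ ∧ ψ) = ⊃I (∧I (⊃E (erase-*-elim φ) (∧E₁ hyp₀)) (⊃E (erase-*-elim ψ) (∧E₂ hyp₀)))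
  erase-*-elim (φ ∨ ψ) = ⊃I (∨E hyp₀ (∨I₁ (⊃E (erase-*-elim φ) hyp₀)) (∨I₂ (⊃E (erase-*-elim ψ) hyp₀)))
  erase-*-elim (φ ⊃ ψ) = ⊃I (⊃I (⊃E (erase-*-elim ψ) (⊃E hyp₁ (⊃E (erase-*-intro φ) hyp₀))))
  erase-*-elim (∀̇ σ φ) = ∀̇-mono (λ _ → ⊃I (⊃E (erase-*-elim φ) (⊃E hyp₀ ⊤̇-intro)))
  erase-*-elim (∃̇ σ φ) = ∃̇-mono (λ _ → ⊃I (⊃E (erase-*-elim φ) (∧E₂ hyp₀)))
  erase-*-intro ⊥̇       = ⊃I hyp₀
  erase-*-intro (s ≣ t) = ⊃I hyp₀
  erase-*-intro (φ ∧ ψ) = ⊃I (∧I (⊃E (erase-*-intro φ) (∧E₁ hyp₀)) (⊃E (erase-*-intro ψ) (∧E₂ hyp₀)))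
  erase-*-intro (φ ∨ ψ) = ⊃I (∨E hyp₀ (∨I₁ (⊃E (erase-*-intro φ) hyp₀)) (∨I₂ (⊃E (erase-*-intro ψ) hyp₀)))
  erase-*-intro (φ ⊃ ψ) = ⊃I (⊃I (⊃E (erase-*-intro ψ) (⊃E hyp₁ (⊃E (erase-*-elim φ) hyp₀))))
  erase-*-intro (∀̇ σ φ) = ∀̇-mono (λ _ → ⊃I (⊃I (⊃E (erase-*-intro φ) hyp₁)))
  erase-*-intro (∃̇ σ φ) = ∃̇-mono (λ _ → ⊃I (∧I ⊤̇-intro (⊃E (erase-*-intro φ) hyp₀)))

  erase-guard-elim : ∀ {Γ Δ step} → GuardStep Γ step
                   → ∀ ψ l → E Γ Δ (erase (foldr step ψ l)) → E Γ Δ (erase ψ)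
  erase-guard-elim step-eq ψ []            d = d
  erase-guard-elim {step = step} step-eq ψ ((τ , y) ∷ l) d
    rewrite step-eq y (foldr step ψ l) = erase-guard-elim step-eq ψ l (⊃E d ⊤̇-intro)

module Hereditary where

  private
    Hd = Deriv HEHA

    hha : ∀ {Γ Δ φ} → HHA Γ φ → Hd Γ Δ φ
    hha a = ax (base a)

    ha : ∀ {Γ Δ φ} → HAax hered Γ φ → Hd Γ Δ φ
    ha a = hha (base a)

  ≐-ext : ∀ {Γ Δ σ τ} (f g : Tm Γ (σ →ᵗ τ))
        → Hd (σ ∷ Γ) (Ext (var vz) ∷ map wkF Δ) (wkT f · var vz ≐ wkT g · var vz) → Hd Γ Δ (f ≐ g)
  ≐-ext f g d = ⊃E (∧E₂ (hha (=→ f g))) (∀I (⊃I d))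

  ≐-app : ∀ {Γ Δ σ τ} (f g : Tm Γ (σ →ᵗ τ)) (x : Tm Γ σ)
        → Hd Γ Δ (f ≐ g) → Hd Γ Δ (Ext x) → Hd Γ Δ (f · x ≐ g · x)
  ≐-app f g x d e = ⊃E (subst (Hd _ _) instance-eq (∀E (⊃E (∧E₁ (hha (=→ f g))) d) x)) e
    where
    instance-eq : (Ext x ⊃ subT (sub0 x) (wkT f) · x ≐ subT (sub0 x) (wkT g) · x) ≡ (Ext x ⊃ f · x ≐ g · x)
    instance-eq = cong₂ (λ a b → Ext x ⊃ a · x ≐ b · x) (subT-sub0-wkT x f) (subT-sub0-wkT x g)

  ≣-cong : ∀ {Γ Δ σ τ} (c : Tm Γ (σ →ᵗ τ)) (s t : Tm Γ σ) → Hd Γ Δ (s ≣ t) → Hd Γ Δ (c · s ≣ c · t)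
  ≣-cong c s t d = ⊃E (⊃E (ha (≡-app c c s t)) (ha (≡-refl c))) d

  ≐-components : ∀ {Γ Δ σ τ} (s t : Tm Γ (σ ×ᵗ τ)) → Hd Γ Δ (s ≐ t)
               → Hd Γ Δ (con (Fst σ τ) · s ≐ con (Fst σ τ) · t ∧ con (Snd σ τ) · s ≐ con (Snd σ τ) · t)
  ≐-components s t d = ⊃E (∧E₁ (hha (=× s t))) d

  ≣⇒≐ : ∀ σ {Γ Δ} (s t : Tm Γ σ) → Hd Γ Δ (s ≣ t ⊃ s ≐ t)
  ≣⇒≐ nat      s t = ⊃I (⊃E (∧E₂ (hha (=₀ s t))) hyp₀)
  ≣⇒≐ (σ ×ᵗ τ) s t = ⊃I (⊃E (∧E₂ (hha (=× s t)))
    (∧I (⊃E (≣⇒≐ σ _ _) (≣-cong _ s t hyp₀)) (⊃E (≣⇒≐ τ _ _) (≣-cong _ s t hyp₀))))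
  ≣⇒≐ (σ →ᵗ τ) s t = ⊃I (≐-ext s t (⊃E (≣⇒≐ τ _ _)
    (⊃E (⊃E (ha (≡-app _ _ _ _)) hyp₁) (ha (≡-refl _)))))

  ≐-sym : ∀ σ {Γ Δ} (s t : Tm Γ σ) → Hd Γ Δ (s ≐ t ⊃ t ≐ s)
  ≐-sym nat      s t = ⊃I (⊃E (∧E₂ (hha (=₀ t s))) (⊃E (ha (≡-sym s t)) (⊃E (∧E₁ (hha (=₀ s t))) hyp₀)))
  ≐-sym (σ ×ᵗ τ) s t = ⊃I (⊃E (∧E₂ (hha (=× t s)))
    (∧I (⊃E (≐-sym σ _ _) (∧E₁ (≐-components s t hyp₀))) (⊃E (≐-sym τ _ _) (∧E₂ (≐-components s t hyp₀)))))
  ≐-sym (σ →ᵗ τ) s t = ⊃I (≐-ext t s (⊃E (≐-sym τ _ _) (≐-app _ _ _ hyp₁ hyp₀)))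

  ≐-trans : ∀ σ {Γ Δ} (s t u : Tm Γ σ) → Hd Γ Δ (s ≐ t ⊃ t ≐ u ⊃ s ≐ u)
  ≐-trans nat      s t u = ⊃I (⊃I (⊃E (∧E₂ (hha (=₀ s u)))
    (⊃E (⊃E (ha (≡-trans s t u)) (⊃E (∧E₁ (hha (=₀ s t))) hyp₁)) (⊃E (∧E₁ (hha (=₀ t u))) hyp₀))))
  ≐-trans (σ ×ᵗ τ) s t u = ⊃I (⊃I (⊃E (∧E₂ (hha (=× s u)))
    (∧I (⊃E (⊃E (≐-trans σ _ _ _) (∧E₁ (≐-components s t hyp₁))) (∧E₁ (≐-components t u hyp₀)))
        (⊃E (⊃E (≐-trans τ _ _ _) (∧E₂ (≐-components s t hyp₁))) (∧E₂ (≐-components t u hyp₀))))))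
  ≐-trans (σ →ᵗ τ) s t u = ⊃I (⊃I (≐-ext s u
    (⊃E (⊃E (≐-trans τ _ _ _) (≐-app _ _ _ (hyp (there (there (here refl)))) hyp₀))
        (≐-app _ _ _ hyp₁ hyp₀))))

  ExtVars : ∀ Γ → List (Fm hered Γ) → Set
  ExtVars Γ H = ∀ {σ} (x : Var Γ σ) → Ext (var x) ∈ H

  ExtVars-∷ : ∀ {Γ H A} → ExtVars Γ H → ExtVars Γ (A ∷ H)
  ExtVars-∷ e x = there (e x)

  ExtVars-bind : ∀ {Γ σ H H′} → ExtVars Γ H → Ext (var vz) ∈ H′
               → (∀ {A} → A ∈ map (wkF {τ = σ}) H → A ∈ H′) → ExtVars (σ ∷ Γ) H′
  ExtVars-bind e z w vz     = z
  ExtVars-bind e z w (vs x) = w (∈-map⁺ wkF (e x))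

  Ext-term : ∀ {Γ H σ} → ExtVars Γ H → (t : Tm Γ σ) → Hd Γ H (Ext t)
  Ext-term e (var x) = hyp (e x)
  Ext-term e (con c) = hha (Ext-con c)
  Ext-term e (t · u) = ⊃E (⊃E (hha (Ext-app t u)) (Ext-term e t)) (Ext-term e u)

  *-axiom : ∀ {Γ H φ} → EHA Γ φ → ExtVars Γ H → Hd Γ H (φ *)
  *-axiom (base (≡-refl t))         e = ⊃E (≣⇒≐ _ t t) (ha (≡-refl t))
  *-axiom (base (≡-sym s t))        e = ≐-sym _ s t
  *-axiom (base (≡-trans s t u))    e = ≐-trans _ s t u
  *-axiom (base (≡-app x x' y y'))  e = ⊃I (⊃I (⊃E (⊃E (≐-trans _ _ _ _)
      (≐-app x x' y hyp₁ (Ext-term e₂ y)))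
      (⊃E (⊃E (⊃E (⊃E (ax (he x' y y')) (Ext-term e₂ x')) (Ext-term e₂ y)) (Ext-term e₂ y')) hyp₀)))
    where
    e₂ = ExtVars-∷ (ExtVars-∷ e)
  *-axiom (base (k-ax x y))         e = ⊃E (≣⇒≐ _ _ _) (ha (k-ax x y))
  *-axiom (base (s-ax x y z))       e = ⊃E (≣⇒≐ _ _ _) (ha (s-ax x y z))
  *-axiom (base (fst-ax x y))       e = ⊃E (≣⇒≐ _ _ _) (ha (fst-ax x y))
  *-axiom (base (snd-ax x y))       e = ⊃E (≣⇒≐ _ _ _) (ha (snd-ax x y))
  *-axiom (base (R0-ax x y))        e = ⊃E (≣⇒≐ _ _ _) (ha (R0-ax x y))
  *-axiom (base (RS-ax x y m))      e = ⊃E (≣⇒≐ _ _ _) (ha (RS-ax x y m))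
  *-axiom (base (S-inj x y))        e =
    ⊃I (⊃E (∧E₂ (hha (=₀ x y))) (⊃E (ha (S-inj x y)) (⊃E (∧E₁ (hha (=₀ _ _))) hyp₀)))
  *-axiom (base (S≢0 x))            e = ⊃I (⊃E (ha (S≢0 x)) (⊃E (∧E₁ (hha (=₀ _ _))) hyp₀))
  -- Every natural number is extensional (Ext₀), so the guards of (ind φ)* can be dropped.
  *-axiom (base (ind φ))            e rewrite *-subF (sub0 zeroᵗ) φ | *-subF succSub φ =
    ⊃I (⊃I (⊃E (∀̇-mono (λ _ → ⊃I (⊃I hyp₁)))
      (⊃E (⊃E (ha (ind (φ *))) hyp₁)
          (⊃E (∀̇-mono (λ _ → ⊃I (⊃E hyp₀ (∀E (hha Ext₀) (var vz))))) hyp₀))))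
  *-axiom (ext-× x y)               e = hha (=× x y)
  *-axiom (ext-→ f g)               e = hha (=→ f g)

  *-deriv : ∀ {Γ Δ φ} → Deriv EHA Γ Δ φ → (H : List (Fm hered Γ)) → Covers _* Δ H → ExtVars Γ H
          → Hd Γ H (φ *)
  *-deriv (hyp p)       H c e = hyp (c p)
  *-deriv (ax a)        H c e = *-axiom a e
  *-deriv (⊥E d)        H c e = ⊥E (*-deriv d H c e)
  *-deriv (∧I d d')     H c e = ∧I (*-deriv d H c e) (*-deriv d' H c e)
  *-deriv (∧E₁ d)       H c e = ∧E₁ (*-deriv d H c e)
  *-deriv (∧E₂ d)       H c e = ∧E₂ (*-deriv d H c e)
  *-deriv (∨I₁ d)       H c e = ∨I₁ (*-deriv d H c e)
  *-deriv (∨I₂ d)       H c e = ∨I₂ (*-deriv d H c e)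
  *-deriv (∨E {φ = A} {ψ = B} d d₁ d₂) H c e =
    ∨E (*-deriv d H c e) (*-deriv d₁ _ (covers-∷ A c) (ExtVars-∷ e)) (*-deriv d₂ _ (covers-∷ B c) (ExtVars-∷ e))
  *-deriv (⊃I {φ = A} d) H c e = ⊃I (*-deriv d _ (covers-∷ A c) (ExtVars-∷ e))
  *-deriv (⊃E d d')     H c e = ⊃E (*-deriv d H c e) (*-deriv d' H c e)
  *-deriv (∀I d)        H c e =
    ∀I (⊃I (*-deriv d _ (λ p → there (covers-wkF _* *-renF c p)) (ExtVars-bind e (here refl) there)))
  *-deriv (∀E {φ = φ} d t) H c e =
    subst (Hd _ _) (sym (*-subF (sub0 t) φ)) (⊃E (∀E (*-deriv d H c e) t) (Ext-term e t))
  *-deriv (∃I {φ = φ} t d) H c e =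
    ∃I t (∧I (Ext-term e t) (subst (Hd _ _) (*-subF (sub0 t) φ) (*-deriv d H c e)))
  *-deriv (∃E {Γ} {σ = σ} {φ = φ} {ψ = ψ} d d') H c e =
    ∃E (*-deriv d H c e) (cut (cut body (∧E₂ hyp₁)) (∧E₁ hyp₀))
    where
    H′ : List (Fm hered (σ ∷ Γ))
    H′ = φ * ∷ Ext (var vz) ∷ (Ext (var vz) ∧ φ *) ∷ map wkF H
    body : Hd (σ ∷ Γ) H′ (wkF (ψ *))
    body = subst (Hd _ _) (*-renF vs ψ)
      (*-deriv d' H′ (covers-∷ φ (λ p → there (there (covers-wkF _* *-renF c p))))
                     (ExtVars-bind e (there (here refl)) (λ p → there (there (there p)))))

  guard-intro : ∀ {Γ step} → GuardStep Γ step → ∀ {ψ} → (∀ {H} → ExtVars Γ H → Hd Γ H ψ)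
              → ∀ l H → (∀ {σ} (x : Var Γ σ) → (σ , x) ∈ l ⊎ Ext (var x) ∈ H)
              → Hd Γ H (foldr step ψ l)
  guard-intro step-eq d [] H cover = d ext
    where
    ext : ExtVars _ H
    ext x with cover x
    ... | inj₁ ()
    ... | inj₂ p = p
  guard-intro {step = step} step-eq {ψ} d ((τ , y) ∷ l) H cover
    rewrite step-eq y (foldr step ψ l) = ⊃I (guard-intro step-eq d l _ cover′)
    where
    cover′ : ∀ {σ} (x : Var _ σ) → (σ , x) ∈ l ⊎ Ext (var x) ∈ (Ext (var y) ∷ H)
    cover′ x with cover x
    ... | inj₁ (here refl) = inj₂ (here refl)
    ... | inj₁ (there p)   = inj₁ p
    ... | inj₂ p           = inj₂ (there p)

  ∈-vars : ∀ {Γ σ} (x : Var Γ σ) → (σ , x) ∈ vars Γ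
  ∈-vars vz     = here refl
  ∈-vars (vs x) = there (∈-map⁺ _ (∈-vars x))

theorem4p1 : ∀ {Γ : Ctx} (φ : Fm plain Γ) → (EHA ⊢ φ) ⇔ (HEHA ⊢ extGuard Γ (φ *))
theorem4p1 {Γ} φ = mk⇔ to from
  where
  open Erasure
  open Hereditary

  to : EHA ⊢ φ → HEHA ⊢ extGuard Γ (φ *)
  to d = guard-intro (λ _ _ → refl) (*-deriv d _ (λ ())) (vars Γ) [] (λ x → inj₁ (∈-vars x))

  from : HEHA ⊢ extGuard Γ (φ *) → EHA ⊢ φ
  from d = ⊃E (erase-*-elim φ) (erase-guard-elim (λ _ _ → refl) (φ *) (vars Γ) (erase-deriv d [] (λ ())))
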